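{- For every $\sigma\in C_n$, $\mathsf{inv}_C(\sigma)=e_1+e_2+\cdots+e_n$, where $(e_1,\dots,e_n)=\Psi(\sigma)$.
   Context: $C_n$ is the set of signed permutations $\sigma=(\sigma_1,\dots,\sigma_n)$ (integer sequences with $(|\sigma_1|,\dots,|\sigma_n|)$ a permutation of $\{1,\dots,n\}$). $\mathsf{inv}(\sigma)=\#\{(j,i):1\le j<i\le n,\ \sigma_j>\sigma_i\}$, $\mathsf{nsp}(\sigma)=\#\{(j,i):1\le j<i\le n,\ \sigma_j+\sigma_i<0\}$, $\mathsf{neg}(\sigma)=\#\{i:\sigma_i<0\}$, $\mathsf{inv}_C(\sigma)=\mathsf{inv}(\sigma)+\mathsf{neg}(\sigma)+\mathsf{nsp}(\sigma)$. The map $\Psi$: let $e^*_i=\#\{j\in\{1,\dots,i-1\}:|\sigma_j|>|\sigma_i|\}$ and $\Psi(\sigma)=(e_1,\dots,e_n)$ with $e_i=e^*_i$ if $\sigma_i>0$ and $e_i=2i-1-e^*_i$ if $\sigma_i<0$; thus $0\le e_i<2i$. -}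

module Defs where

open import Data.Nat using (ℕ; zero; suc; _+_; _∸_; _*_; _<_; _<?_)
open import Data.Integer as ℤ using (ℤ; ∣_∣; 0ℤ)
open import Data.Fin using (Fin; toℕ)
open import Data.Fin.Permutation using (Permutation′; _⟨$⟩ʳ_)
open import Data.List using (List; sum; map; filter; length; allFin; upTo)
open import Data.List using (concatMap)
open import Data.Product using (_×_; _,_; Σ)
open import Relation.Binary.PropositionalEquality using (_≡_)
open import Relation.Nullary using (Dec; yes; no)
open import Relation.Nullary.Decidable using (⌊_⌋)

-- A signed permutation in C_n: σ = (σ_1,…,σ_n) (indexed by Fin n, position i ↦ σ_{i+1})
-- such that (|σ_1|,…,|σ_n|) is a permutation of {1,…,n}, i.e. there is a
-- permutation π of Fin n with |σ_i| = π(i) + 1.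
IsSignedPerm : (n : ℕ) → (Fin n → ℤ) → Set
IsSignedPerm n σ = Σ (Permutation′ n) λ π → ∀ i → ∣ σ i ∣ ≡ suc (toℕ (π ⟨$⟩ʳ i))

pairs : (n : ℕ) → List (Fin n × Fin n)
pairs n = concatMap (λ i → map (λ j → (j , i)) (filter (λ j → toℕ j <? toℕ i) (allFin n))) (allFin n)

inv : {n : ℕ} → (Fin n → ℤ) → ℕ
inv {n} σ = length (filter (λ p → σ (Data.Product.proj₂ p) ℤ.<? σ (Data.Product.proj₁ p)) (pairs n))

nsp : {n : ℕ} → (Fin n → ℤ) → ℕ
nsp {n} σ = length (filter (λ p → (σ (Data.Product.proj₁ p) ℤ.+ σ (Data.Product.proj₂ p)) ℤ.<? 0ℤ) (pairs n))

neg : {n : ℕ} → (Fin n → ℤ) → ℕ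
neg {n} σ = length (filter (λ i → σ i ℤ.<? 0ℤ) (allFin n))

invC : {n : ℕ} → (Fin n → ℤ) → ℕ
invC σ = inv σ + neg σ + nsp σ

eStar : {n : ℕ} → (Fin n → ℤ) → Fin n → ℕ
eStar {n} σ i = length (filter (λ j → (toℕ j <? toℕ i) ×-dec (∣ σ i ∣ <? ∣ σ j ∣)) (allFin n))
  where open import Relation.Nullary.Decidable using (_×-dec_)

-- Ψ(σ) = (e_1,…,e_n); with 1-based position i = toℕ k + 1:
-- e_i = e*_i if σ_i > 0, and e_i = 2i − 1 − e*_i if σ_i < 0.
Ψ : {n : ℕ} → (Fin n → ℤ) → Fin n → ℕ
Ψ σ k with σ k ℤ.<? 0ℤ
... | yes _ = (2 * suc (toℕ k) ∸ 1) ∸ eStar σ k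
... | no  _ = eStar σ k

-- Group the pairs (j , i) counted by inv and nsp by their larger index i, and let b = σ_j
-- range over the earlier entries, so that |b| ≠ |σ_i|. If σ_i > 0, at most one of
-- σ_i < b and b + σ_i < 0 holds, and one does exactly when |b| > |σ_i|; so position i
-- contributes e*_i. If σ_i < 0, exactly two of σ_i < b, b + σ_i < 0 and |b| > |σ_i| hold;
-- so position i contributes 2(i − 1) − e*_i to inv + nsp, and 1 more to neg.
module Submission where

open import Defs
open import Data.Bool using (true; false; if_then_else_)
open import Data.Fin as Fin using (Fin; toℕ)
open import Data.Fin.Properties using (toℕ-injective)
open import Data.Integer as ℤ using (ℤ; -[1+_]; ∣_∣; 0ℤ; _⊖_)
open import Data.Integer.Properties using ([1+m]⊖[1+n]≡m⊖n)
open import Data.List using (List; []; _∷_; _++_; map; filter; length; concatMap; allFin)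
open import Data.List.Properties using (length-++; length-map; filter-++; filter-none; filter-≐; map-cong; map-cong-local; map-tabulate)
open import Data.List.Relation.Unary.All as All using (All)
open import Data.List.Relation.Unary.All.Properties using (all-filter; map⁺)
open import Data.Nat as ℕ using (ℕ; zero; suc; _+_; _*_; _∸_; s<s; s<s⁻¹)
open import Data.Nat.ListAction using (sum)
open import Data.Nat.Properties
open import Algebra.Properties.CommutativeSemigroup +-commutativeSemigroup using (interchange)
open import Data.Product using (_×_; _,_)
open import Function using (_∘_)
open import Function.Bundles using (Injection)
open import Function.Properties.Inverse using (↔⇒↣)
open import Relation.Nullary using (Dec; does; ¬_; yes; no; contradiction)
open import Relation.Nullary.Decidable using (_×-dec_)
open import Relation.Unary using (Pred; Decidable)
open import Relation.Binary.PropositionalEquality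
open ≡-Reasoning

indicator : ∀ {p} {P : Set p} → Dec P → ℕ
indicator P? = if does P? then 1 else 0

sum-map-+ : ∀ {a} {A : Set a} (f g : A → ℕ) xs →
            sum (map (λ x → f x + g x) xs) ≡ sum (map f xs) + sum (map g xs)
sum-map-+ f g []       = refl
sum-map-+ f g (x ∷ xs) = begin
  f x + g x + sum (map (λ x → f x + g x) xs)     ≡⟨ cong ((f x + g x) +_) (sum-map-+ f g xs) ⟩
  f x + g x + (sum (map f xs) + sum (map g xs)) ≡⟨ interchange (f x) (g x) _ _ ⟩
  f x + sum (map f xs) + (g x + sum (map g xs)) ∎

sum-map-const : ∀ {a} {A : Set a} c (xs : List A) → sum (map (λ _ → c) xs) ≡ c * length xs
sum-map-const c []       = sym (*-zeroʳ c)
sum-map-const c (x ∷ xs) = trans (cong (c +_) (sum-map-const c xs)) (sym (*-suc c (length xs)))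

module _ {a p} {A : Set a} {P : Pred A p} (P? : Decidable P) where

  length-filter≡sum-indicator : ∀ xs → length (filter P? xs) ≡ sum (map (indicator ∘ P?) xs)
  length-filter≡sum-indicator []       = refl
  length-filter≡sum-indicator (x ∷ xs) with does (P? x)
  ... | true  = cong suc (length-filter≡sum-indicator xs)
  ... | false = length-filter≡sum-indicator xs

  length-filter-map : ∀ {b} {B : Set b} (f : B → A) xs →
                      length (filter P? (map f xs)) ≡ length (filter (P? ∘ f) xs)
  length-filter-map f []       = refl
  length-filter-map f (x ∷ xs) with does (P? (f x))
  ... | true  = cong suc (length-filter-map f xs)
  ... | false = length-filter-map f xs

  length-filter-concatMap : ∀ {b} {B : Set b} (f : B → List A) xs →
                            length (filter P? (concatMap f xs)) ≡ sum (map (length ∘ filter P? ∘ f) xs)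
  length-filter-concatMap f []       = refl
  length-filter-concatMap f (x ∷ xs) = begin
    length (filter P? (f x ++ concatMap f xs))
      ≡⟨ cong length (filter-++ P? (f x) (concatMap f xs)) ⟩
    length (filter P? (f x) ++ filter P? (concatMap f xs))
      ≡⟨ length-++ (filter P? (f x)) ⟩
    length (filter P? (f x)) + length (filter P? (concatMap f xs))
      ≡⟨ cong (length (filter P? (f x)) +_) (length-filter-concatMap f xs) ⟩
    length (filter P? (f x)) + sum (map (length ∘ filter P? ∘ f) xs) ∎

  filter-filter : ∀ {q} {Q : Pred A q} (Q? : Decidable Q) xs →
                  filter Q? (filter P? xs) ≡ filter (λ x → P? x ×-dec Q? x) xs
  filter-filter Q? []       = refl
  filter-filter Q? (x ∷ xs) with does (P? x)
  ... | false = filter-filter Q? xs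
  ... | true with does (Q? x)
  ...   | true  = cong (x ∷_) (filter-filter Q? xs)
  ...   | false = filter-filter Q? xs

earlier : ∀ {n} → Fin n → List (Fin n)
earlier {n} i = filter (λ j → toℕ j ℕ.<? toℕ i) (allFin n)

allFin-suc : ∀ n → allFin (suc n) ≡ Fin.zero ∷ map Fin.suc (allFin n)
allFin-suc n = cong (Fin.zero ∷_) (sym (map-tabulate (λ j → j) Fin.suc))

length-earlier : ∀ {n} (i : Fin n) → length (earlier i) ≡ toℕ i
length-earlier {suc n} Fin.zero = begin
  length (filter (λ j → toℕ j ℕ.<? 0) (allFin (suc n)))
    ≡⟨ cong (length ∘ filter (λ j → toℕ j ℕ.<? 0)) (allFin-suc n) ⟩
  length (filter (λ j → toℕ j ℕ.<? 0) (map Fin.suc (allFin n)))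
    ≡⟨ length-filter-map (λ j → toℕ j ℕ.<? 0) Fin.suc (allFin n) ⟩
  length (filter (λ j → suc (toℕ j) ℕ.<? 0) (allFin n))
    ≡⟨ cong length (filter-none (λ j → suc (toℕ j) ℕ.<? 0) (All.universal (λ _ ()) (allFin n))) ⟩
  0 ∎
length-earlier {suc n} (Fin.suc i) = begin
  length (filter (λ j → toℕ j ℕ.<? suc (toℕ i)) (allFin (suc n)))
    ≡⟨ cong (length ∘ filter (λ j → toℕ j ℕ.<? suc (toℕ i))) (allFin-suc n) ⟩
  suc (length (filter (λ j → toℕ j ℕ.<? suc (toℕ i)) (map Fin.suc (allFin n))))
    ≡⟨ cong suc (length-filter-map (λ j → toℕ j ℕ.<? suc (toℕ i)) Fin.suc (allFin n)) ⟩
  suc (length (filter (λ j → suc (toℕ j) ℕ.<? suc (toℕ i)) (allFin n)))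
    ≡⟨ cong (suc ∘ length) (filter-≐ _ _ (s<s⁻¹ , s<s) (allFin n)) ⟩
  suc (length (earlier i))
    ≡⟨ cong suc (length-earlier i) ⟩
  suc (toℕ i) ∎

length-filter-pairs : ∀ {n p} {P : Pred (Fin n × Fin n) p} (P? : Decidable P) →
                      length (filter P? (pairs n)) ≡
                      sum (map (λ i → length (filter (λ j → P? (j , i)) (earlier i))) (allFin n))
length-filter-pairs {n} P? = begin
  length (filter P? (pairs n))
    ≡⟨ length-filter-concatMap P? (λ i → map (_, i) (earlier i)) (allFin n) ⟩
  sum (map (λ i → length (filter P? (map (_, i) (earlier i)))) (allFin n))
    ≡⟨ cong sum (map-cong (λ i → length-filter-map P? (_, i) (earlier i)) (allFin n)) ⟩
  sum (map (λ i → length (filter (λ j → P? (j , i)) (earlier i))) (allFin n)) ∎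

⊖<0-does : ∀ m n → does ((m ⊖ n) ℤ.<? 0ℤ) ≡ does (m ℕ.<? n)
⊖<0-does zero    zero    = refl
⊖<0-does zero    (suc n) = refl
⊖<0-does (suc m) zero    = refl
⊖<0-does (suc m) (suc n) rewrite [1+m]⊖[1+n]≡m⊖n m n = ⊖<0-does m n

indicator-<+indicator-> : ∀ m n → m ≢ n → indicator (m ℕ.<? n) + indicator (n ℕ.<? m) ≡ 1
indicator-<+indicator-> zero    zero    m≢n = contradiction refl m≢n
indicator-<+indicator-> zero    (suc n) _   = refl
indicator-<+indicator-> (suc m) zero    _   = refl
indicator-<+indicator-> (suc m) (suc n) m≢n = indicator-<+indicator-> m n (m≢n ∘ cong suc)

nonnegative-pair : ∀ {a} b → ¬ a ℤ.< 0ℤ → ∣ b ∣ ≢ ∣ a ∣ →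
                   indicator (a ℤ.<? b) + indicator ((b ℤ.+ a) ℤ.<? 0ℤ) ≡ indicator (∣ a ∣ ℕ.<? ∣ b ∣)
nonnegative-pair {ℤ.+ m}     (ℤ.+ n)  _   _ = +-identityʳ _
nonnegative-pair {ℤ.+ m}     -[1+ n ] _   _ = cong (λ t → if t then 1 else 0) (⊖<0-does m (suc n))
nonnegative-pair { -[1+ m ]} _        a≮0 _ = contradiction ℤ.-<+ a≮0

negative-pair : ∀ {a} b → a ℤ.< 0ℤ → ∣ b ∣ ≢ ∣ a ∣ →
                indicator (a ℤ.<? b) + indicator ((b ℤ.+ a) ℤ.<? 0ℤ) + indicator (∣ a ∣ ℕ.<? ∣ b ∣) ≡ 2
negative-pair {ℤ.+ m}     _        (ℤ.+<+ ()) _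
negative-pair { -[1+ m ]} (ℤ.+ n)  _ n≢1+m rewrite ⊖<0-does n (suc m) =
  cong suc (indicator-<+indicator-> n (suc m) n≢1+m)
negative-pair { -[1+ m ]} -[1+ n ] _ 1+n≢1+m = begin
  indicator (n ℕ.<? m) + 1 + indicator (m ℕ.<? n) ≡⟨ cong (_+ indicator (m ℕ.<? n)) (+-comm (indicator (n ℕ.<? m)) 1) ⟩
  1 + indicator (n ℕ.<? m) + indicator (m ℕ.<? n) ≡⟨ cong suc (indicator-<+indicator-> n m (1+n≢1+m ∘ cong suc)) ⟩
  2                                               ∎

module _ {a : ℤ} {bs : List ℤ} (distinct : All (λ b → ∣ b ∣ ≢ ∣ a ∣) bs) where

  count-pairs-nonnegative : ¬ a ℤ.< 0ℤ →
    length (filter (a ℤ.<?_) bs) + length (filter (λ b → (b ℤ.+ a) ℤ.<? 0ℤ) bs) ≡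
    length (filter (λ b → ∣ a ∣ ℕ.<? ∣ b ∣) bs)
  count-pairs-nonnegative a≮0 = begin
    length (filter (a ℤ.<?_) bs) + length (filter (λ b → (b ℤ.+ a) ℤ.<? 0ℤ) bs)
      ≡⟨ cong₂ _+_ (length-filter≡sum-indicator _ bs) (length-filter≡sum-indicator _ bs) ⟩
    sum (map (λ b → indicator (a ℤ.<? b)) bs) + sum (map (λ b → indicator ((b ℤ.+ a) ℤ.<? 0ℤ)) bs)
      ≡⟨ sum-map-+ _ _ bs ⟨
    sum (map (λ b → indicator (a ℤ.<? b) + indicator ((b ℤ.+ a) ℤ.<? 0ℤ)) bs)
      ≡⟨ cong sum (map-cong-local (All.map (λ {b} → nonnegative-pair b a≮0) distinct)) ⟩
    sum (map (λ b → indicator (∣ a ∣ ℕ.<? ∣ b ∣)) bs)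
      ≡⟨ length-filter≡sum-indicator _ bs ⟨
    length (filter (λ b → ∣ a ∣ ℕ.<? ∣ b ∣) bs) ∎

  count-pairs-negative : a ℤ.< 0ℤ →
    length (filter (a ℤ.<?_) bs) + length (filter (λ b → (b ℤ.+ a) ℤ.<? 0ℤ) bs) +
    length (filter (λ b → ∣ a ∣ ℕ.<? ∣ b ∣) bs) ≡ 2 * length bs
  count-pairs-negative a<0 = begin
    length (filter (a ℤ.<?_) bs) + length (filter (λ b → (b ℤ.+ a) ℤ.<? 0ℤ) bs) +
    length (filter (λ b → ∣ a ∣ ℕ.<? ∣ b ∣) bs)
      ≡⟨ cong₂ _+_ (cong₂ _+_ (length-filter≡sum-indicator _ bs) (length-filter≡sum-indicator _ bs))
                   (length-filter≡sum-indicator _ bs) ⟩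
    sum (map (λ b → indicator (a ℤ.<? b)) bs) + sum (map (λ b → indicator ((b ℤ.+ a) ℤ.<? 0ℤ)) bs) +
    sum (map (λ b → indicator (∣ a ∣ ℕ.<? ∣ b ∣)) bs)
      ≡⟨ cong (_+ sum (map (λ b → indicator (∣ a ∣ ℕ.<? ∣ b ∣)) bs)) (sum-map-+ _ _ bs) ⟨
    sum (map (λ b → indicator (a ℤ.<? b) + indicator ((b ℤ.+ a) ℤ.<? 0ℤ)) bs) +
    sum (map (λ b → indicator (∣ a ∣ ℕ.<? ∣ b ∣)) bs)
      ≡⟨ sum-map-+ _ _ bs ⟨
    sum (map (λ b → indicator (a ℤ.<? b) + indicator ((b ℤ.+ a) ℤ.<? 0ℤ) + indicator (∣ a ∣ ℕ.<? ∣ b ∣)) bs)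
      ≡⟨ cong sum (map-cong-local (All.map (λ {b} → negative-pair b a<0) distinct)) ⟩
    sum (map (λ _ → 2) bs)
      ≡⟨ sum-map-const 2 bs ⟩
    2 * length bs ∎

m+n+o≡2k⇒m+1+n≡2[1+k]∸1∸o : ∀ m n o k → m + n + o ≡ 2 * k → m + 1 + n ≡ 2 * suc k ∸ 1 ∸ o
m+n+o≡2k⇒m+1+n≡2[1+k]∸1∸o m n o k m+n+o≡2k = sym (begin
  2 * suc k ∸ 1 ∸ o      ≡⟨ cong (λ t → t ∸ 1 ∸ o) (*-suc 2 k) ⟩
  suc (2 * k) ∸ o        ≡⟨ cong (λ t → suc t ∸ o) m+n+o≡2k ⟨
  suc (m + n) + o ∸ o    ≡⟨ m+n∸n≡m (suc (m + n)) o ⟩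
  suc (m + n)            ≡⟨ cong suc (+-comm m n) ⟩
  suc n + m              ≡⟨ +-comm (suc n) m ⟩
  m + suc n              ≡⟨ +-assoc m 1 n ⟨
  m + 1 + n              ∎)

module _ {n} (σ : Fin n → ℤ) where

  before : Fin n → List ℤ
  before i = map σ (earlier i)

  invAt nspAt : Fin n → ℕ
  invAt i = length (filter (σ i ℤ.<?_) (before i))
  nspAt i = length (filter (λ b → (b ℤ.+ σ i) ℤ.<? 0ℤ) (before i))

  inv≡sum-invAt : inv σ ≡ sum (map invAt (allFin n))
  inv≡sum-invAt = trans (length-filter-pairs (λ (j , i) → σ i ℤ.<? σ j))
    (cong sum (map-cong (λ i → sym (length-filter-map (σ i ℤ.<?_) σ (earlier i))) (allFin n)))

  nsp≡sum-nspAt : nsp σ ≡ sum (map nspAt (allFin n))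
  nsp≡sum-nspAt = trans (length-filter-pairs (λ (j , i) → (σ j ℤ.+ σ i) ℤ.<? 0ℤ))
    (cong sum (map-cong (λ i → sym (length-filter-map (λ b → (b ℤ.+ σ i) ℤ.<? 0ℤ) σ (earlier i))) (allFin n)))

  eStar≡count-before : ∀ i → eStar σ i ≡ length (filter (λ b → ∣ σ i ∣ ℕ.<? ∣ b ∣) (before i))
  eStar≡count-before i = begin
    eStar σ i
      ≡⟨ cong length (filter-filter (λ j → toℕ j ℕ.<? toℕ i) (λ j → ∣ σ i ∣ ℕ.<? ∣ σ j ∣) (allFin n)) ⟨
    length (filter (λ j → ∣ σ i ∣ ℕ.<? ∣ σ j ∣) (earlier i))
      ≡⟨ length-filter-map (λ b → ∣ σ i ∣ ℕ.<? ∣ b ∣) σ (earlier i) ⟨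
    length (filter (λ b → ∣ σ i ∣ ℕ.<? ∣ b ∣) (before i)) ∎

  length-before : ∀ i → length (before i) ≡ toℕ i
  length-before i = trans (length-map σ (earlier i)) (length-earlier i)

  invAt+neg+nspAt≡Ψ : ∀ i → All (λ b → ∣ b ∣ ≢ ∣ σ i ∣) (before i) →
                      invAt i + indicator (σ i ℤ.<? 0ℤ) + nspAt i ≡ Ψ σ i
  invAt+neg+nspAt≡Ψ i distinct with σ i ℤ.<? 0ℤ
  ... | yes σi<0 = begin
    invAt i + 1 + nspAt i
      ≡⟨ m+n+o≡2k⇒m+1+n≡2[1+k]∸1∸o (invAt i) (nspAt i) _ (length (before i)) (count-pairs-negative distinct σi<0) ⟩
    2 * suc (length (before i)) ∸ 1 ∸ length (filter (λ b → ∣ σ i ∣ ℕ.<? ∣ b ∣) (before i))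
      ≡⟨ cong₂ (λ k c → 2 * suc k ∸ 1 ∸ c) (length-before i) (sym (eStar≡count-before i)) ⟩
    2 * suc (toℕ i) ∸ 1 ∸ eStar σ i ∎
  ... | no σi≮0 = begin
    invAt i + 0 + nspAt i
      ≡⟨ cong (_+ nspAt i) (+-identityʳ (invAt i)) ⟩
    invAt i + nspAt i
      ≡⟨ count-pairs-nonnegative distinct σi≮0 ⟩
    length (filter (λ b → ∣ σ i ∣ ℕ.<? ∣ b ∣) (before i))
      ≡⟨ eStar≡count-before i ⟨
    eStar σ i ∎

∣σ∣-injective : ∀ {n} {σ : Fin n → ℤ} → IsSignedPerm n σ → ∀ {i j} → ∣ σ i ∣ ≡ ∣ σ j ∣ → i ≡ j
∣σ∣-injective (π , ∣σ∣≡1+π) {i} {j} ∣σi∣≡∣σj∣ = Injection.injective (↔⇒↣ π)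
  (toℕ-injective (suc-injective (trans (sym (∣σ∣≡1+π i)) (trans ∣σi∣≡∣σj∣ (∣σ∣≡1+π j)))))

distinct-before : ∀ {n} {σ : Fin n → ℤ} → IsSignedPerm n σ → ∀ i → All (λ b → ∣ b ∣ ≢ ∣ σ i ∣) (before σ i)
distinct-before {n} {σ} σ-signed i = map⁺ (All.map ∣σj∣≢∣σi∣ (all-filter (λ j → toℕ j ℕ.<? toℕ i) (allFin n)))
  where
  ∣σj∣≢∣σi∣ : ∀ {j} → toℕ j ℕ.< toℕ i → ∣ σ j ∣ ≢ ∣ σ i ∣
  ∣σj∣≢∣σi∣ j<i ∣σj∣≡∣σi∣ = <-irrefl (cong toℕ (∣σ∣-injective {σ = σ} σ-signed ∣σj∣≡∣σi∣)) j<i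

mainTheorem9 : (n : ℕ) (σ : Fin n → ℤ) → IsSignedPerm n σ →
               invC σ ≡ sum (map (Ψ σ) (allFin n))
mainTheorem9 n σ σ-signed = begin
  inv σ + neg σ + nsp σ
    ≡⟨ cong₂ _+_ (cong₂ _+_ (inv≡sum-invAt σ) (length-filter≡sum-indicator _ (allFin n))) (nsp≡sum-nspAt σ) ⟩
  sum (map (invAt σ) (allFin n)) + sum (map negAt (allFin n)) + sum (map (nspAt σ) (allFin n))
    ≡⟨ cong (_+ sum (map (nspAt σ) (allFin n))) (sum-map-+ (invAt σ) negAt (allFin n)) ⟨
  sum (map (λ i → invAt σ i + negAt i) (allFin n)) + sum (map (nspAt σ) (allFin n))
    ≡⟨ sum-map-+ _ (nspAt σ) (allFin n) ⟨
  sum (map (λ i → invAt σ i + negAt i + nspAt σ i) (allFin n))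
    ≡⟨ cong sum (map-cong (λ i → invAt+neg+nspAt≡Ψ σ i (distinct-before {σ = σ} σ-signed i)) (allFin n)) ⟩
  sum (map (Ψ σ) (allFin n)) ∎
  where
  negAt : Fin n → ℕ
  negAt i = indicator (σ i ℤ.<? 0ℤ)
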